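{- Let $(X,S)$ be a primitive association scheme and let $q$ be a prime power. Set $r=\operatorname{rk}_{\min}(\mathbb{F}_q,S)$. Then $$|X|\le\frac{q^{r}-1}{q-1}$$ whenever $r>1$. If $r=1$, then $|X|<q$ and $(X,S)$ is a thin scheme of prime order.
   Context: An association scheme $(X,S)$ consists of a finite set $X$ and a partition $S$ of $X\times X$ that is closed under transposition of relations, contains the diagonal $\Delta=\{(x,x):x\in X\}$, and such that for all $r,s,t\in S$ the number $c_{r,s}^t=|\{z\in X:(x,z)\in r,(z,y)\in s\}|$ does not depend on the choice of $(x,y)\in t$. The valency of $r\in S$ is $d_r=c_{r,r^*}^{\Delta}$, where $r^*$ is the transpose of $r$. $S^*$ denotes the set of all unions of subsets of $S$. The scheme is primitive if $|X|\ge 2$ and every equivalence relation on $X$ belonging to $S^*$ is either $\Delta$ or $X\times X$. It is thin if $d_r=1$ for all $r\in S$. For a field $F$, the adjacency algebra $FS$ is the $F$-linear span in the matrix algebra $\mathrm{Mat}_X(F)$ of the adjacency matrices $A_s$ ($s\in S$), where $A_s$ is the $\{0,1\}$-matrix with $(A_s)_{x,y}=1$ iff $(x,y)\in s$. $J$ denotes the all-one matrix, and $\operatorname{rk}_{\min}(F,S)=\min_{A\in FS\setminus FJ}\operatorname{rk}(A)$. The order of the scheme is $|X|$. -}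

module Defs where

open import Level using (Level; _⊔_) renaming (suc to lsuc)
open import Data.Nat using (ℕ; zero; suc; _^_; _≤_; _<_)
import Data.Nat as ℕ
open import Data.Nat.Primality using (Prime)
open import Data.Fin using (Fin; zero; suc)
open import Data.Fin.Properties using (_≟_)
open import Data.Bool using (Bool; true; false; if_then_else_)
open import Data.Product using (Σ; ∃; ∃-syntax; _×_; _,_)
open import Data.Sum using (_⊎_)
open import Relation.Nullary using (¬_; does)
open import Relation.Binary.PropositionalEquality using (_≡_)
open import Algebra.Bundles using (CommutativeRing)

count : ∀ {n} → (Fin n → Bool) → ℕ
count {zero}  p = 0
count {suc n} p = (if p zero then 1 else 0) ℕ.+ count (λ i → p (suc i))

_==_ : ∀ {n} → Fin n → Fin n → Bool
i == j = does (i ≟ j)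

-- Association schemes.
-- X = Fin n; the partition S of X × X into m classes is given by the
-- function rel : Fin n → Fin n → Fin m sending (x , y) to the index of
-- the class containing it.

record AssocScheme (n m : ℕ) : Set where
  field
    rel : Fin n → Fin n → Fin m
    nonempty : ∀ (s : Fin m) → ∃[ x ] ∃[ y ] rel x y ≡ s
    diag : Fin m
    diag-spec : ∀ x y → (rel x y ≡ diag → x ≡ y) × (x ≡ y → rel x y ≡ diag)
    transp : Fin m → Fin m
    transp-spec : ∀ s x y → (rel x y ≡ s → rel y x ≡ transp s)
                          × (rel y x ≡ transp s → rel x y ≡ s)
    intersection : ∀ r s t x y x′ y′ → rel x y ≡ t → rel x′ y′ ≡ t →
      count (λ z → (rel x z == r) Data.Bool.∧ (rel z y == s))
        ≡ count (λ z → (rel x′ z == r) Data.Bool.∧ (rel z y′ == s))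

module _ {n m : ℕ} (S : AssocScheme n m) where
  open AssocScheme S

  -- the relation on X given by the element of S* determined by U ⊆ S
  InUnion : (Fin m → Bool) → Fin n → Fin n → Set
  InUnion U x y = U (rel x y) ≡ true

  IsEquivalenceRel : (Fin n → Fin n → Set) → Set
  IsEquivalenceRel R = (∀ x → R x x) × (∀ x y → R x y → R y x)
                     × (∀ x y z → R x y → R y z → R x z)

  Primitive : Set
  Primitive = 2 ≤ n ×
    (∀ (U : Fin m → Bool) → IsEquivalenceRel (InUnion U) →
       (∀ x y → InUnion U x y → x ≡ y)
       ⊎ (∀ x y → InUnion U x y))

  -- valency d_s = c_{s,s*}^Δ = |{ z : (x,z) ∈ s , (z,x) ∈ s* }| for any x
  valency : Fin m → Fin n → ℕ
  valency s x = count (λ z → (rel x z == s) Data.Bool.∧ (rel z x == transp s))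

  Thin : Set
  Thin = ∀ (s : Fin m) (x : Fin n) → valency s x ≡ 1

record Field (c ℓ : Level) : Set (lsuc (c ⊔ ℓ)) where
  field
    commRing : CommutativeRing c ℓ
  open CommutativeRing commRing public
  field
    0≉1 : ¬ (0# ≈ 1#)
    inverse : ∀ x → ¬ (x ≈ 0#) → ∃[ y ] (x * y ≈ 1#)

HasCard : ∀ {c ℓ} → Field c ℓ → ℕ → Set (c ⊔ ℓ)
HasCard F q = Σ (Fin q → Carrier) λ e →
  (∀ a → ∃[ i ] (e i ≈ a)) × (∀ i j → e i ≈ e j → i ≡ j)
  where open Field F

IsPrimePower : ℕ → Set
IsPrimePower q = ∃[ p ] ∃[ k ] (Prime p × 1 ≤ k × q ≡ p ^ k)

module FieldMatrices {c ℓ : Level} (F : Field c ℓ) where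
  open Field F using (Carrier; _≈_; _+_; _*_; 0#; 1#)

  Matrix : ℕ → Set c
  Matrix n = Fin n → Fin n → Carrier

  ∑ : ∀ {k} → (Fin k → Carrier) → Carrier
  ∑ {zero}  f = 0#
  ∑ {suc k} f = f zero + ∑ (λ i → f (suc i))

  LinIndep : ∀ {k n} → (Fin k → Fin n → Carrier) → Set (c ⊔ ℓ)
  LinIndep {k} {n} v = ∀ (a : Fin k → Carrier) →
    (∀ y → ∑ (λ i → a i * v i y) ≈ 0#) → ∀ i → a i ≈ 0#

  HasRank : ∀ {n} → Matrix n → ℕ → Set (c ⊔ ℓ)
  HasRank {n} M r =
    (Σ (Fin r → Fin n) λ f → LinIndep (λ i → M (f i)))
    × (∀ (f : Fin (suc r) → Fin n) → ¬ LinIndep (λ i → M (f i)))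

  module _ {n m : ℕ} (S : AssocScheme n m) where
    open AssocScheme S

    adj : Fin m → Matrix n
    adj s x y = if rel x y == s then 1# else 0#

    lincomb : (Fin m → Carrier) → Matrix n
    lincomb a x y = ∑ (λ s → a s * adj s x y)

    InFJ : Matrix n → Set (c ⊔ ℓ)
    InFJ M = Σ Carrier λ t → (∀ x y → M x y ≈ t)

    IsRkMin : ℕ → Set (c ⊔ ℓ)
    IsRkMin r =
      (Σ (Fin m → Carrier) λ a → (¬ InFJ (lincomb a) × HasRank (lincomb a) r))
      × (∀ a r′ → ¬ InFJ (lincomb a) → HasRank (lincomb a) r′ → r ≤ r′)

module Submission where

-- Fix A = Σ_s a_s A_s ∈ F S \ F J of rank r.  Its (x,z) entry is a(rel x z), so A is
-- not constant and, since every point meets every relation, no row of A is zero.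
-- Write x ∼[ μ ] y when row x = μ · row y.  Lifting triangles along the intersection
-- numbers shows that x ∼[ μ ] y only depends on the relation containing (x,y); so both
-- "rows proportional" and "rows equal" are equivalence relations in S*, and primitivity
-- makes them trivial or total.  Rows are never all equal (A ∉ F J), so equal rows come
-- from equal points.
--   * Rows pairwise non-proportional: every row lies in the span of r independent rows,
--     and (x, λ ≠ 0) ↦ coordinates of λ · row x injects X × F^× into F^r \ {0}.  This is
--     the bound for r > 1, and contradicts |X| ≥ 2 when r = 1.
--   * All rows proportional, row y = λ_y · row x₀: then r = 1, the λ_y are distinct and
--     nonzero (|X| < q), each relation is a bijection (thin), and for λ_y ≠ 1 the powers of
--     λ_y define an equivalence relation in S* which must be total, so λ_y has order |X|
--     and no proper divisor of |X| exceeds 1: |X| is prime.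

open import Defs
open import Level using (Level; _⊔_)
open import Data.Nat using (ℕ; _*_; _∸_; _^_; _≤_; _<_; _>_)
open import Data.Nat.Primality using (Prime)
open import Data.Product using (_×_)
open import Relation.Binary.PropositionalEquality using (_≡_)

import Data.Nat as ℕ
import Data.Nat.Properties as ℕP
open import Data.Nat.DivMod using (_%_; _/_; m≡m%n+[m/n]*n; m%n<n)
open import Data.Nat.Divisibility using (_∣_; divides)
open import Data.Nat.Divisibility.Core using (hasNonTrivialDivisor)
open import Data.Nat.Primality using (prime)
import Data.Fin as Fin
open import Data.Fin using (Fin; zero; suc; toℕ; fromℕ<; punchIn; funToFin; finToFun; remQuot; combine)
import Data.Fin.Properties as FinP
open import Data.Vec.Functional using (_∷_)
open import Data.Bool using (Bool; true; false; _∧_)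
open import Data.Product using (Σ; ∃₂; ∃-syntax; _,_; proj₁; proj₂; uncurry)
open import Data.Sum using (_⊎_; inj₁; inj₂)
open import Data.Empty using (⊥; ⊥-elim)
open import Relation.Nullary using (¬_; Dec; yes; no; does)
open import Relation.Nullary.Decidable using (decidable-stable; dec-true; dec-false)
open import Relation.Binary.PropositionalEquality as ≡ using (_≢_; refl)
import Algebra.Properties.Ring as RingProperties
import Algebra.Properties.Semiring.Exp as ExpProperties

==⇒≡ : ∀ {n} {i j : Fin n} → (i == j) ≡ true → i ≡ j
==⇒≡ {i = i} {j} eq with i FinP.≟ j
... | yes i≡j = i≡j
==⇒≡ () | no _

≡⇒== : ∀ {n} {i j : Fin n} → i ≡ j → (i == j) ≡ true
≡⇒== {i = i} {j} = dec-true (i FinP.≟ j)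

∧-split : ∀ {b c} → (b ∧ c) ≡ true → (b ≡ true) × (c ≡ true)
∧-split {true} {true} _ = refl , refl

witness⇒count≢0 : ∀ {n} (p : Fin n → Bool) i → p i ≡ true → count p ≢ 0
witness⇒count≢0 p zero pi rewrite pi = λ ()
witness⇒count≢0 p (suc i) pi with p zero
... | true = λ ()
... | false = witness⇒count≢0 (λ j → p (suc j)) i pi

count≢0⇒witness : ∀ {n} (p : Fin n → Bool) → count p ≢ 0 → ∃[ i ] p i ≡ true
count≢0⇒witness {ℕ.zero} p c≢0 = ⊥-elim (c≢0 refl)
count≢0⇒witness {ℕ.suc n} p c≢0 with p zero in p0
... | true = zero , p0
... | false = let (i , pi) = count≢0⇒witness (λ j → p (suc j)) c≢0 in suc i , pi

count-nowhere : ∀ {n} (p : Fin n → Bool) → (∀ i → p i ≡ false) → count p ≡ 0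
count-nowhere {ℕ.zero} p _ = refl
count-nowhere {ℕ.suc n} p none rewrite none zero = count-nowhere (λ i → p (suc i)) (λ i → none (suc i))

count-unique : ∀ {n} (p : Fin n → Bool) (z : Fin n) → p z ≡ true →
  (∀ i → p i ≡ true → i ≡ z) → count p ≡ 1
count-unique p zero pz unique rewrite pz = ≡.cong ℕ.suc (count-nowhere _ elsewhere)
  where
  elsewhere : ∀ i → p (suc i) ≡ false
  elsewhere i with p (suc i) in pi
  ... | false = refl
  ... | true with unique (suc i) pi
  ... | ()
count-unique p (suc z) pz unique with p zero in p0
... | true with unique zero p0
... | ()
count-unique p (suc z) pz unique | false =
  count-unique (λ i → p (suc i)) z pz (λ i pi → FinP.suc-injective (unique (suc i) pi))

skip : ∀ {k} (c : Fin k) → Fin (k ∸ 1) → Fin k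
skip {ℕ.suc k} c = punchIn c

skip-injective : ∀ {k} (c : Fin k) i j → skip c i ≡ skip c j → i ≡ j
skip-injective {ℕ.suc k} c = FinP.punchIn-injective c

skip-avoids : ∀ {k} (c : Fin k) i → skip c i ≢ c
skip-avoids {ℕ.suc k} c = FinP.punchInᵢ≢i c

funToFin-injective : ∀ {k l} (u v : Fin l → Fin k) → funToFin u ≡ funToFin v → ∀ i → u i ≡ v i
funToFin-injective u v eq i = begin
  u i                     ≡⟨ FinP.finToFun-funToFin u i ⟨
  finToFun (funToFin u) i ≡⟨ ≡.cong (λ w → finToFun w i) eq ⟩
  finToFun (funToFin v) i ≡⟨ FinP.finToFun-funToFin v i ⟩
  v i                     ∎
  where open ≡.≡-Reasoning

distinct-points : ∀ {n} → 2 ≤ n → Σ (Fin n) λ x → Σ (Fin n) λ y → y ≢ x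
distinct-points (ℕ.s≤s (ℕ.s≤s _)) = zero , suc zero , λ ()

¬¬-∀ : ∀ {p k} {P : Fin k → Set p} → (∀ i → ¬ ¬ P i) → ¬ ¬ (∀ i → P i)
¬¬-∀ {k = ℕ.zero} _ ¬all = ¬all (λ ())
¬¬-∀ {k = ℕ.suc k} {P} ¬¬P ¬all = ¬¬P zero λ P₀ →
  ¬¬-∀ {P = λ i → P (suc i)} (λ i → ¬¬P (suc i)) λ Pₛ → ¬all λ { zero → P₀ ; (suc i) → Pₛ i }

product-injection-bound : ∀ {a b c} (Ψ : Fin a × Fin b → Fin c) →
  (∀ u v → Ψ u ≡ Ψ v → u ≡ v) → (o : Fin c) → (∀ u → Ψ u ≢ o) → a * b < c
product-injection-bound {a} {b} {c} Ψ Ψ-inj o Ψ≢o = FinP.injective⇒≤ {f = Φ} (λ {u} {v} → Φ-inj u v)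
  where
  Φ : Fin (ℕ.suc (a * b)) → Fin c
  Φ zero = o
  Φ (suc k) = Ψ (remQuot {a} b k)
  Φ-inj : ∀ u v → Φ u ≡ Φ v → u ≡ v
  Φ-inj zero zero _ = refl
  Φ-inj zero (suc k) eq = ⊥-elim (Ψ≢o _ (≡.sym eq))
  Φ-inj (suc k) zero eq = ⊥-elim (Ψ≢o _ eq)
  Φ-inj (suc k) (suc k′) eq = ≡.cong suc (begin
    k                                  ≡⟨ FinP.combine-remQuot {a} b k ⟨
    uncurry combine (remQuot {a} b k)  ≡⟨ ≡.cong (uncurry combine) (Ψ-inj _ _ eq) ⟩
    uncurry combine (remQuot {a} b k′) ≡⟨ FinP.combine-remQuot {a} b k′ ⟩
    k′                                 ∎)
    where open ≡.≡-Reasoning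

module SchemeFacts {n m : ℕ} (S : AssocScheme n m) where
  open AssocScheme S

  -- Triangles lift: if (x,y) and (x′,y′) lie in one relation, a point z′ on a triangle
  -- over (x′,y′) has a counterpart z over (x,y), because c_{s,t}^{rel x y} ≠ 0.
  lift : ∀ {x y x′ y′} → rel x y ≡ rel x′ y′ → ∀ z′ →
    ∃[ z ] (rel x z ≡ rel x′ z′ × rel z y ≡ rel z′ y′)
  lift {x} {y} {x′} {y′} same z′ =
    let (z , on-triangle) = count≢0⇒witness (triangle x y) count≢0
        (xz , zy) = ∧-split on-triangle
    in z , ==⇒≡ xz , ==⇒≡ zy
    where
    triangle : Fin n → Fin n → Fin n → Bool
    triangle u v z = (rel u z == rel x′ z′) ∧ (rel z v == rel z′ y′)
    z′-on-triangle : triangle x′ y′ z′ ≡ true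
    z′-on-triangle rewrite ≡⇒== {i = rel x′ z′} refl | ≡⇒== {i = rel z′ y′} refl = refl
    count≢0 : count (triangle x y) ≢ 0
    count≢0 c≡0 = witness⇒count≢0 (triangle x′ y′) z′ z′-on-triangle
      (≡.trans (≡.sym (intersection (rel x′ z′) (rel z′ y′) (rel x′ y′) x y x′ y′ same refl)) c≡0)

  out-neighbour : ∀ x s → ∃[ z ] rel x z ≡ s
  out-neighbour x s =
    let (x′ , y′ , e) = nonempty s
        (z , xz , _) = lift (≡.trans (proj₂ (diag-spec x x) refl) (≡.sym (proj₂ (diag-spec x′ x′) refl))) y′
    in z , ≡.trans xz e

  in-neighbour : ∀ z s → ∃[ x ] rel x z ≡ s
  in-neighbour z s = let (x , e) = out-neighbour z (transp s) in x , proj₂ (transp-spec s x z) e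

  Invariant : ∀ {ℓ} → (Fin n → Fin n → Set ℓ) → Set ℓ
  Invariant R = ∀ {x y x′ y′} → rel x y ≡ rel x′ y′ → R x y → R x′ y′

  -- In a primitive scheme, a decidable invariant equivalence relation is Δ or X × X:
  -- it is the relation of the union U of those classes of S on which it holds.
  module _ {ℓ} (R : Fin n → Fin n → Set ℓ) (R? : ∀ x y → Dec (R x y)) (invariant : Invariant R) where
    private
      U : Fin m → Bool
      U s = does (R? (proj₁ (nonempty s)) (proj₁ (proj₂ (nonempty s))))

      toU : ∀ {x y} → R x y → InUnion S U x y
      toU {x} {y} Rxy with nonempty (rel x y)
      ... | (x₀ , y₀ , e) = dec-true (R? x₀ y₀) (invariant (≡.sym e) Rxy)

      fromU : ∀ {x y} → InUnion S U x y → R x y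
      fromU {x} {y} u with nonempty (rel x y)
      ... | (x₀ , y₀ , e) with R? x₀ y₀
      ... | yes R₀ = invariant e R₀
      fromU {x} {y} () | (x₀ , y₀ , e) | no _

    primitive-trivial : Primitive S →
      (∀ x → R x x) → (∀ {x y} → R x y → R y x) → (∀ {x y z} → R x y → R y z → R x z) →
      (∀ x y → R x y → x ≡ y) ⊎ (∀ x y → R x y)
    primitive-trivial (_ , trivial) reflexive symmetric transitive
      with trivial U ((λ x → toU (reflexive x)) , (λ x y u → toU (symmetric (fromU u))) ,
                      (λ x y z u v → toU (transitive (fromU u) (fromU v))))
    ... | inj₁ diagonal = inj₁ (λ x y Rxy → diagonal x y (toU Rxy))
    ... | inj₂ total = inj₂ (λ x y → fromU (total x y))

  thin-if-functional : (∀ {x z z′} → rel x z ≡ rel x z′ → z ≡ z′) → Thin S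
  thin-if-functional functional s x =
    count-unique _ z on-z (λ z′ p → functional (≡.trans (==⇒≡ (proj₁ (∧-split p))) (≡.sym xz)))
    where
    z = proj₁ (out-neighbour x s)
    xz = proj₂ (out-neighbour x s)
    on-z : ((rel x z == s) ∧ (rel z x == transp s)) ≡ true
    on-z rewrite ≡⇒== {i = rel x z} xz | ≡⇒== {i = rel z x} (proj₁ (transp-spec s x z) xz) = refl

module FieldFacts {c ℓ} (F : Field c ℓ) where
  open Field F public using (Carrier; _≈_; 0#; 1#; -_; inverse; 0≉1)
  open Field F using (setoid; *-comm; *-assoc; *-identityˡ; *-identityʳ; *-cong; zeroˡ; zeroʳ;
                      +-cong; +-identityˡ; +-identityʳ; distribˡ; ring; semiring; -‿inverseʳ)
    renaming (_*_ to _·_; _+_ to _⊕_; refl to ≈-refl; sym to ≈-sym; trans to ≈-trans)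
  open FieldMatrices F public using (∑; LinIndep)
  open import Relation.Binary.Reasoning.Setoid setoid
  open RingProperties ring using (-1*x≈-x; -‿distribˡ-*; -‿distribʳ-*; -‿injective; -‿involutive; -0#≈0#)
  open ExpProperties semiring public using (^-congʳ; ^-homo-*; ^-assocʳ) renaming (_^_ to _^ᶠ_)

  NonZero : Carrier → Set ℓ
  NonZero x = ¬ (x ≈ 0#)

  cancel : ∀ {k x y} → NonZero k → k · x ≈ k · y → x ≈ y
  cancel {k} {x} {y} k≉0 kx≈ky =
    let (k⁻¹ , kk⁻¹≈1) = inverse k k≉0
        k⁻¹k≈1 = ≈-trans (*-comm k⁻¹ k) kk⁻¹≈1
    in begin
      x              ≈⟨ *-identityˡ x ⟨
      1# · x         ≈⟨ *-cong k⁻¹k≈1 ≈-refl ⟨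
      (k⁻¹ · k) · x  ≈⟨ *-assoc k⁻¹ k x ⟩
      k⁻¹ · (k · x)  ≈⟨ *-cong ≈-refl kx≈ky ⟩
      k⁻¹ · (k · y)  ≈⟨ *-assoc k⁻¹ k y ⟨
      (k⁻¹ · k) · y  ≈⟨ *-cong k⁻¹k≈1 ≈-refl ⟩
      1# · y         ≈⟨ *-identityˡ y ⟩
      y              ∎

  nonzero-· : ∀ {x y} → NonZero x → NonZero y → NonZero (x · y)
  nonzero-· {x} x≉0 y≉0 xy≈0 = y≉0 (cancel x≉0 (≈-trans xy≈0 (≈-sym (zeroʳ x))))

  nonzero-^ : ∀ {x} → NonZero x → ∀ k → NonZero (x ^ᶠ k)
  nonzero-^ x≉0 ℕ.zero 1≈0 = 0≉1 (≈-sym 1≈0)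
  nonzero-^ x≉0 (ℕ.suc k) = nonzero-· x≉0 (nonzero-^ x≉0 k)

  ^-multiple : ∀ {x} b → x ^ᶠ b ≈ 1# → ∀ t → x ^ᶠ (t * b) ≈ 1#
  ^-multiple b xᵇ≈1 ℕ.zero = ≈-refl
  ^-multiple {x} b xᵇ≈1 (ℕ.suc t) = begin
    x ^ᶠ (b ℕ.+ t * b)      ≈⟨ ^-homo-* x b (t * b) ⟩
    x ^ᶠ b · x ^ᶠ (t * b)   ≈⟨ *-cong xᵇ≈1 (^-multiple b xᵇ≈1 t) ⟩
    1# · 1#                 ≈⟨ *-identityˡ 1# ⟩
    1#                      ∎

  ^-mod : ∀ {x} b .{{_ : ℕ.NonZero b}} → x ^ᶠ b ≈ 1# → ∀ j → x ^ᶠ j ≈ x ^ᶠ (j % b)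
  ^-mod {x} b xᵇ≈1 j = begin
    x ^ᶠ j                             ≈⟨ ^-congʳ x (m≡m%n+[m/n]*n j b) ⟩
    x ^ᶠ (j % b ℕ.+ (j / b) * b)        ≈⟨ ^-homo-* x (j % b) _ ⟩
    x ^ᶠ (j % b) · x ^ᶠ ((j / b) * b)   ≈⟨ *-cong ≈-refl (^-multiple b xᵇ≈1 (j / b)) ⟩
    x ^ᶠ (j % b) · 1#                   ≈⟨ *-identityʳ _ ⟩
    x ^ᶠ (j % b)                        ∎

  ∑-cong : ∀ {k} {f g : Fin k → Carrier} → (∀ i → f i ≈ g i) → ∑ f ≈ ∑ g
  ∑-cong {ℕ.zero} f≈g = ≈-refl
  ∑-cong {ℕ.suc k} f≈g = +-cong (f≈g zero) (∑-cong (λ i → f≈g (suc i)))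

  ∑-zero : ∀ {k} (f : Fin k → Carrier) → (∀ i → f i ≈ 0#) → ∑ f ≈ 0#
  ∑-zero {ℕ.zero} f f≈0 = ≈-refl
  ∑-zero {ℕ.suc k} f f≈0 = ≈-trans (+-cong (f≈0 zero) (∑-zero _ (λ i → f≈0 (suc i)))) (+-identityˡ 0#)

  ∑-scale : ∀ {k} (x : Carrier) (f : Fin k → Carrier) → x · ∑ f ≈ ∑ (λ i → x · f i)
  ∑-scale {ℕ.zero} x f = zeroʳ x
  ∑-scale {ℕ.suc k} x f = ≈-trans (distribˡ x _ _) (+-cong ≈-refl (∑-scale x (λ i → f (suc i))))

  ∑-single : ∀ {k} (f : Fin k → Carrier) (t : Fin k) → (∀ s → s ≢ t → f s ≈ 0#) → ∑ f ≈ f t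
  ∑-single {ℕ.suc k} f zero others =
    ≈-trans (+-cong ≈-refl (∑-zero _ (λ i → others (suc i) (λ ())))) (+-identityʳ (f zero))
  ∑-single {ℕ.suc k} f (suc t) others =
    ≈-trans (+-cong (others zero (λ ())) (∑-single _ t (λ s s≢t → others (suc s) (λ e → s≢t (FinP.suc-injective e)))))
            (+-identityˡ (f (suc t)))

  -- Two vectors of an independent family are not proportional: v₁ = μ · v₀ is a relation.
  independent⇒not-proportional : ∀ {k n} (v : Fin (ℕ.suc (ℕ.suc k)) → Fin n → Carrier) →
    LinIndep v → ∀ μ → ¬ (∀ z → v (suc zero) z ≈ μ · v zero z)
  independent⇒not-proportional {k} v independent μ v₁≈μv₀ = 0≉1 (≈-sym 1≈0)
    where
    coefficient : Fin (ℕ.suc (ℕ.suc k)) → Carrier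
    coefficient zero = μ
    coefficient (suc zero) = - 1#
    coefficient (suc (suc _)) = 0#
    relation : ∀ z → ∑ (λ i → coefficient i · v i z) ≈ 0#
    relation z = begin
      μ · v zero z ⊕ ((- 1#) · v (suc zero) z ⊕ ∑ (λ i → 0# · v (suc (suc i)) z))
        ≈⟨ +-cong (≈-sym (v₁≈μv₀ z)) (+-cong (-1*x≈-x _) (∑-zero (λ i → 0# · v (suc (suc i)) z) (λ i → zeroˡ _))) ⟩
      v (suc zero) z ⊕ (- v (suc zero) z ⊕ 0#)   ≈⟨ +-cong ≈-refl (+-identityʳ _) ⟩
      v (suc zero) z ⊕ (- v (suc zero) z)        ≈⟨ -‿inverseʳ _ ⟩
      0#                                         ∎
    1≈0 : 1# ≈ 0#
    1≈0 = -‿injective (≈-trans (independent coefficient relation (suc zero)) (≈-sym -0#≈0#))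

  neg·neg : ∀ x y → (- x) · (- y) ≈ x · y
  neg·neg x y = begin
    (- x) · (- y)  ≈⟨ -‿distribˡ-* x (- y) ⟨
    - (x · (- y))  ≈⟨ Field.-‿cong F (-‿distribʳ-* x y) ⟨
    - (- (x · y))  ≈⟨ -‿involutive (x · y) ⟩
    x · y          ∎

module FiniteField {c ℓ} (F : Field c ℓ) {q : ℕ} (card : HasCard F q) where
  open FieldFacts F
  open Field F using (setoid; *-comm; *-assoc; *-identityˡ; *-cong; zeroˡ; +-cong; +-identityˡ)
    renaming (_*_ to _·_; refl to ≈-refl; sym to ≈-sym; trans to ≈-trans; reflexive to ≈-reflexive)
  open import Relation.Binary.Reasoning.Setoid setoid
  open RingProperties (Field.ring F) using (+-inverseʳ-unique)

  element : Fin q → Carrier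
  element = proj₁ card

  code : Carrier → Fin q
  code x = proj₁ (proj₁ (proj₂ card) x)

  element-code : ∀ x → element (code x) ≈ x
  element-code x = proj₂ (proj₁ (proj₂ card) x)

  code-element : ∀ i → code (element i) ≡ i
  code-element i = proj₂ (proj₂ card) _ _ (element-code (element i))

  code-≈ : ∀ {x y} → x ≈ y → code x ≡ code y
  code-≈ {x} {y} x≈y = proj₂ (proj₂ card) _ _ (≈-trans (element-code x) (≈-trans x≈y (≈-sym (element-code y))))

  code-≡ : ∀ {x y} → code x ≡ code y → x ≈ y
  code-≡ {x} {y} eq = ≈-trans (≈-sym (element-code x)) (≈-trans (≈-reflexive (≡.cong element eq)) (element-code y))

  infix 4 _≈?_
  _≈?_ : ∀ x y → Dec (x ≈ y)
  x ≈? y with code x FinP.≟ code y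
  ... | yes eq = yes (code-≡ eq)
  ... | no neq = no (λ x≈y → neq (code-≈ x≈y))

  two≤q : 2 ≤ q
  two≤q = FinP.injective⇒≤ {f = zero-one} (λ {i} {j} → injective i j)
    where
    zero-one : Fin 2 → Fin q
    zero-one zero = code 0#
    zero-one (suc _) = code 1#
    injective : ∀ i j → zero-one i ≡ zero-one j → i ≡ j
    injective zero zero _ = refl
    injective zero (suc zero) eq = ⊥-elim (0≉1 (code-≡ eq))
    injective (suc zero) zero eq = ⊥-elim (0≉1 (code-≡ (≡.sym eq)))
    injective (suc zero) (suc zero) _ = refl

  unit : Fin (q ∸ 1) → Carrier
  unit j = element (skip (code 0#) j)

  unit-nonzero : ∀ j → NonZero (unit j)
  unit-nonzero j j≈0 = skip-avoids (code 0#) j (≡.trans (≡.sym (code-element _)) (code-≈ j≈0))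

  unit-injective : ∀ i j → unit i ≈ unit j → i ≡ j
  unit-injective i j eq = skip-injective (code 0#) i j (proj₂ (proj₂ card) _ _ eq)

  InSpan : ∀ {k n} → (Fin k → Fin n → Carrier) → (Fin n → Carrier) → Set (c ⊔ ℓ)
  InSpan {k} v u = Σ (Fin k → Carrier) λ coeff → ∀ z → u z ≈ ∑ (λ i → coeff i · v i z)

  -- If v zero , v 1 , … is dependent but v 1 , v 2 , … is independent, then v zero is
  -- in the span of the others (doubly negated: the dependence is only known negatively).
  dependent⇒in-span : ∀ {k n} (v : Fin (ℕ.suc k) → Fin n → Carrier) →
    LinIndep (λ i → v (suc i)) → ¬ LinIndep v → ¬ ¬ InSpan (λ i → v (suc i)) (v zero)
  dependent⇒in-span v tail-independent dependent ¬span = dependent independent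
    where
    independent : LinIndep v
    independent coeff relation with coeff zero ≈? 0#
    ... | yes c₀≈0 = λ { zero → c₀≈0 ; (suc i) → tail-independent (λ i → coeff (suc i)) tail-relation i }
      where
      tail-relation : ∀ z → ∑ (λ i → coeff (suc i) · v (suc i) z) ≈ 0#
      tail-relation z = ≈-trans (≈-sym (+-identityˡ _))
        (≈-trans (+-cong (≈-sym (≈-trans (*-cong c₀≈0 ≈-refl) (zeroˡ (v zero z)))) ≈-refl) (relation z))
    ... | no c₀≉0 = ⊥-elim (¬span (solution , solves))
      where
      d = proj₁ (inverse (coeff zero) c₀≉0)
      dc₀≈1 : d · coeff zero ≈ 1#
      dc₀≈1 = ≈-trans (*-comm _ _) (proj₂ (inverse (coeff zero) c₀≉0))
      solution : Fin _ → Carrier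
      solution i = (- d) · coeff (suc i)
      solves : ∀ z → v zero z ≈ ∑ (λ i → solution i · v (suc i) z)
      solves z = ≈-sym (begin
        ∑ (λ i → solution i · v (suc i) z)       ≈⟨ ∑-cong (λ i → *-assoc (- d) (coeff (suc i)) (v (suc i) z)) ⟩
        ∑ (λ i → (- d) · (coeff (suc i) · v (suc i) z))
          ≈⟨ ∑-scale (- d) (λ i → coeff (suc i) · v (suc i) z) ⟨
        (- d) · ∑ (λ i → coeff (suc i) · v (suc i) z)
          ≈⟨ *-cong ≈-refl (+-inverseʳ-unique _ _ (relation z)) ⟩
        (- d) · (- (coeff zero · v zero z))      ≈⟨ neg·neg d _ ⟩
        d · (coeff zero · v zero z)              ≈⟨ *-assoc _ _ _ ⟨
        (d · coeff zero) · v zero z              ≈⟨ *-cong dc₀≈1 ≈-refl ⟩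
        1# · v zero z                            ≈⟨ *-identityˡ _ ⟩
        v zero z                                 ∎)

module Rows {c ℓ} (F : Field c ℓ) {q : ℕ} (card : HasCard F q)
  {n m : ℕ} (S : AssocScheme n m) (prim : Primitive S) (a : Fin m → Field.Carrier F)
  (a∉FJ : ¬ FieldMatrices.InFJ F S (FieldMatrices.lincomb F S a)) where
  open FieldFacts F
  open FiniteField F card
  open FieldMatrices F using (Matrix; lincomb; adj)
  open Field F using (setoid; *-comm; *-assoc; *-identityˡ; *-identityʳ; *-cong; zeroˡ; zeroʳ)
    renaming (_*_ to _·_; refl to ≈-refl; sym to ≈-sym; trans to ≈-trans; reflexive to ≈-reflexive)
  open import Relation.Binary.Reasoning.Setoid setoid
  open AssocScheme S
  open SchemeFacts S

  A : Matrix n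
  A = lincomb S a

  entry : ∀ x z → A x z ≈ a (rel x z)
  entry x z = ≈-trans (∑-single _ (rel x z) others) (≈-trans (*-cong ≈-refl on-diagonal) (*-identityʳ _))
    where
    on-diagonal : adj S (rel x z) x z ≈ 1#
    on-diagonal rewrite ≡⇒== {i = rel x z} refl = ≈-refl
    others : ∀ s → s ≢ rel x z → a s · adj S s x z ≈ 0#
    others s s≢ rewrite dec-false (rel x z FinP.≟ s) (λ e → s≢ (≡.sym e)) = zeroʳ _

  a-nonconstant : ∀ {t} → ¬ (∀ s → a s ≈ t)
  a-nonconstant {t} constant = a∉FJ (t , λ x y → ≈-trans (entry x y) (constant (rel x y)))

  -- ... and no row of A vanishes, since row x takes every value a s.
  row-nonzero : ∀ x → ¬ (∀ z → A x z ≈ 0#)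
  row-nonzero x zero-row = a-nonconstant (λ s →
    let (z , xz) = out-neighbour x s
    in ≈-trans (≈-reflexive (≡.cong a (≡.sym xz))) (≈-trans (≈-sym (entry x z)) (zero-row z)))

  nonzero-entry : ∀ x → ∃[ z ] NonZero (A x z)
  nonzero-entry x = FinP.¬∀⟶∃¬ n _ (λ z → A x z ≈? 0#) (row-nonzero x)

  infix 4 _∼[_]_
  _∼[_]_ : Fin n → Carrier → Fin n → Set ℓ
  x ∼[ μ ] y = ∀ z → A x z ≈ μ · A y z

  ∼-dec : ∀ x μ y → Dec (x ∼[ μ ] y)
  ∼-dec x μ y = FinP.all? (λ z → A x z ≈? (μ · A y z))

  ∼-resp : ∀ {x y μ ν} → μ ≈ ν → x ∼[ μ ] y → x ∼[ ν ] y
  ∼-resp μ≈ν x∼y z = ≈-trans (x∼y z) (*-cong μ≈ν ≈-refl)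

  ∼-refl : ∀ {x} → x ∼[ 1# ] x
  ∼-refl z = ≈-sym (*-identityˡ _)

  ∼-flip : ∀ {x y μ ν} → ν · μ ≈ 1# → x ∼[ μ ] y → y ∼[ ν ] x
  ∼-flip {x} {y} {μ} {ν} νμ≈1 x∼y z = begin
    A y z            ≈⟨ *-identityˡ _ ⟨
    1# · A y z       ≈⟨ *-cong νμ≈1 ≈-refl ⟨
    (ν · μ) · A y z  ≈⟨ *-assoc ν μ _ ⟩
    ν · (μ · A y z)  ≈⟨ *-cong ≈-refl (x∼y z) ⟨
    ν · A x z        ∎

  ∼-trans : ∀ {x y w μ ν} → x ∼[ μ ] y → y ∼[ ν ] w → x ∼[ μ · ν ] w
  ∼-trans {x} {y} {w} {μ} {ν} x∼y y∼w z = begin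
    A x z            ≈⟨ x∼y z ⟩
    μ · A y z        ≈⟨ *-cong ≈-refl (y∼w z) ⟩
    μ · (ν · A w z)  ≈⟨ *-assoc μ ν _ ⟨
    (μ · ν) · A w z  ∎

  ∼-factor-unique : ∀ {x y μ ν} → x ∼[ μ ] y → x ∼[ ν ] y → μ ≈ ν
  ∼-factor-unique {x} {y} {μ} {ν} x∼μy x∼νy =
    let (z , yz≉0) = nonzero-entry y
    in cancel yz≉0 (≈-trans (*-comm _ μ) (≈-trans (≈-sym (x∼μy z)) (≈-trans (x∼νy z) (*-comm ν _))))

  ∼-factor-nonzero : ∀ {x y μ} → x ∼[ μ ] y → NonZero μ
  ∼-factor-nonzero {x} x∼y μ≈0 = row-nonzero x (λ z → ≈-trans (x∼y z) (≈-trans (*-cong μ≈0 ≈-refl) (zeroˡ _)))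

  ∼-inverse : ∀ {x y μ} → x ∼[ μ ] y → ∃[ ν ] (ν · μ ≈ 1#)
  ∼-inverse x∼y = let (ν , μν≈1) = inverse _ (∼-factor-nonzero x∼y) in ν , ≈-trans (*-comm _ _) μν≈1

  -- The key invariance: x ∼[ μ ] y depends only on rel x y (by lifting triangles).
  ∼-invariant : ∀ {μ} → Invariant (_∼[ μ ]_)
  ∼-invariant {μ} {x} {y} {x′} {y′} same x∼y z′ =
    let (z , xz , zy) = lift same z′
        yz : rel y z ≡ rel y′ z′
        yz = ≡.trans (proj₁ (transp-spec _ z y) zy) (≡.sym (proj₁ (transp-spec _ z′ y′) refl))
    in begin
      A x′ z′       ≈⟨ entry x′ z′ ⟩
      a (rel x′ z′) ≈⟨ ≈-reflexive (≡.cong a (≡.sym xz)) ⟩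
      a (rel x z)   ≈⟨ entry x z ⟨
      A x z         ≈⟨ x∼y z ⟩
      μ · A y z     ≈⟨ *-cong ≈-refl (≈-trans (entry y z) (≈-reflexive (≡.cong a yz))) ⟩
      μ · a (rel y′ z′) ≈⟨ *-cong ≈-refl (entry y′ z′) ⟨
      μ · A y′ z′   ∎

  -- Equal rows come from equal points: "equal rows" is an invariant equivalence relation,
  -- and it is not total because then a would be constant.
  equal-rows : ∀ {x y} → x ∼[ 1# ] y → x ≡ y
  equal-rows {x₀} {y₀} with primitive-trivial (_∼[ 1# ]_) (λ x y → ∼-dec x 1# y) ∼-invariant prim
    (λ x → ∼-refl) (∼-flip (*-identityˡ 1#)) (λ x∼y y∼z → ∼-resp (*-identityˡ 1#) (∼-trans x∼y y∼z))
  ... | inj₁ diagonal = diagonal x₀ y₀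
  ... | inj₂ total = ⊥-elim (a-nonconstant {t = A x₀ x₀} λ s →
          let (x , xx₀) = in-neighbour x₀ s in
          ≈-trans (≈-reflexive (≡.cong a (≡.sym xx₀)))
            (≈-trans (≈-sym (entry x x₀)) (≈-trans (total x x₀ x₀) (*-identityˡ _))))

  ∼-same : ∀ {x y w μ} → x ∼[ μ ] w → y ∼[ μ ] w → x ≡ y
  ∼-same x∼w y∼w = equal-rows (λ z → ≈-trans (x∼w z) (≈-trans (≈-sym (y∼w z)) (≈-sym (*-identityˡ _))))

  Proportional : Fin n → Fin n → Set (c ⊔ ℓ)
  Proportional x y = ∃[ μ ] x ∼[ μ ] y

  proportional-dec : ∀ x y → Dec (Proportional x y)
  proportional-dec x y with FinP.any? (λ i → ∼-dec x (element i) y)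
  ... | yes (i , x∼y) = yes (element i , x∼y)
  ... | no none = no (λ (μ , x∼y) → none (code μ , ∼-resp (≈-sym (element-code μ)) x∼y))

  Dichotomy : Set (c ⊔ ℓ)
  Dichotomy = (∀ x y → Proportional x y → x ≡ y) ⊎ (∀ x y → Proportional x y)

  proportional-trivial : Dichotomy
  proportional-trivial = primitive-trivial Proportional proportional-dec
    (λ same (μ , x∼y) → μ , ∼-invariant same x∼y) prim
    (λ x → 1# , ∼-refl)
    (λ (μ , x∼y) → let (ν , νμ≈1) = ∼-inverse x∼y in ν , ∼-flip νμ≈1 x∼y)
    (λ (μ , x∼y) (ν , y∼w) → μ · ν , ∼-trans x∼y y∼w)

  module NonProportional (distinct : ∀ x y → Proportional x y → x ≡ y)
    {r : ℕ} (f : Fin r → Fin n) (independent : LinIndep (λ i → A (f i)))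
    (maximal : ∀ (g : Fin (ℕ.suc r) → Fin n) → ¬ LinIndep (λ i → A (g i))) where

    Spanned : Set (c ⊔ ℓ)
    Spanned = ∀ x → InSpan (λ i → A (f i)) (A x)

    spanned : ¬ ¬ Spanned
    spanned = ¬¬-∀ (λ x → dependent⇒in-span (λ i → A ((x ∷ f) i)) independent (maximal (x ∷ f)))

    -- Given coordinates of all rows, (x , j) ↦ coordinates of unit j · row x is injective
    -- (rows are pairwise non-proportional) and never the zero vector (rows are nonzero).
    module _ (span : Spanned) where
      coords : Fin n → Fin r → Carrier
      coords x = proj₁ (span x)

      scaled : ∀ λ′ x z → λ′ · A x z ≈ ∑ (λ i → (λ′ · coords x i) · A (f i) z)
      scaled λ′ x z = begin
        λ′ · A x z                                ≈⟨ *-cong ≈-refl (proj₂ (span x) z) ⟩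
        λ′ · ∑ (λ i → coords x i · A (f i) z)     ≈⟨ ∑-scale λ′ (λ i → coords x i · A (f i) z) ⟩
        ∑ (λ i → λ′ · (coords x i · A (f i) z))   ≈⟨ ∑-cong (λ i → *-assoc λ′ (coords x i) _) ⟨
        ∑ (λ i → (λ′ · coords x i) · A (f i) z)   ∎

      encode : Fin n × Fin (q ∸ 1) → Fin (q ^ r)
      encode (x , j) = funToFin (λ i → code (unit j · coords x i))

      zero-vector : Fin (q ^ r)
      zero-vector = funToFin (λ (i : Fin r) → code 0#)

      encode-nonzero : ∀ u → encode u ≢ zero-vector
      encode-nonzero (x , j) eq = row-nonzero x (λ z → cancel (unit-nonzero j) (begin
        unit j · A x z                                 ≈⟨ scaled (unit j) x z ⟩
        ∑ (λ i → (unit j · coords x i) · A (f i) z)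
          ≈⟨ ∑-zero (λ i → (unit j · coords x i) · A (f i) z)
               (λ i → ≈-trans (*-cong (code-≡ (funToFin-injective _ _ eq i)) ≈-refl) (zeroˡ _)) ⟩
        0#                                             ≈⟨ zeroʳ _ ⟨
        unit j · 0#                                    ∎))

      encode-injective : ∀ u v → encode u ≡ encode v → u ≡ v
      encode-injective (x , j) (x′ , j′) eq = ≡.cong₂ _,_ x≡x′ j≡j′
        where
        same-rows : ∀ z → unit j · A x z ≈ unit j′ · A x′ z
        same-rows z = ≈-trans (scaled (unit j) x z) (≈-trans
          (∑-cong (λ i → *-cong (code-≡ (funToFin-injective _ _ eq i)) (≈-refl {A (f i) z})))
          (≈-sym (scaled (unit j′) x′ z)))
        x≡x′ : x ≡ x′
        x≡x′ = let (ν , λν≈1) = inverse (unit j) (unit-nonzero j)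
                   νλ≈1 = ≈-trans (*-comm ν _) λν≈1 in
          distinct x x′ (ν · unit j′ , λ z → begin
            A x z                 ≈⟨ *-identityˡ _ ⟨
            1# · A x z            ≈⟨ *-cong νλ≈1 ≈-refl ⟨
            (ν · unit j) · A x z  ≈⟨ *-assoc _ _ _ ⟩
            ν · (unit j · A x z)  ≈⟨ *-cong ≈-refl (same-rows z) ⟩
            ν · (unit j′ · A x′ z) ≈⟨ *-assoc _ _ _ ⟨
            (ν · unit j′) · A x′ z ∎)
        j≡j′ : j ≡ j′
        j≡j′ = let (z , xz≉0) = nonzero-entry x in unit-injective j j′ (cancel xz≉0 (begin
          A x z · unit j     ≈⟨ *-comm _ _ ⟩
          unit j · A x z     ≈⟨ same-rows z ⟩
          unit j′ · A x′ z   ≡⟨ ≡.cong (λ w → unit j′ · A w z) (≡.sym x≡x′) ⟩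
          unit j′ · A x z    ≈⟨ *-comm _ _ ⟩
          A x z · unit j′    ∎))

    bound : n * (q ∸ 1) ≤ q ^ r ∸ 1
    bound = decidable-stable (_ ℕP.≤? _) λ ¬bound → spanned λ span →
      ¬bound (ℕP.m+n≤o⇒m≤o∸n _ (ℕP.≤-trans (ℕP.≤-reflexive (ℕP.+-comm _ 1))
        (product-injection-bound (encode span) (encode-injective span) (zero-vector span) (encode-nonzero span))))

  module AllProportional (total : ∀ x y → Proportional x y) where

    -- Two proportional rows are dependent, so the rank is at most 1.
    rank≤1 : ∀ {k} (g : Fin k → Fin n) → LinIndep (λ i → A (g i)) → k ≤ 1
    rank≤1 {ℕ.zero} g _ = ℕ.z≤n
    rank≤1 {ℕ.suc ℕ.zero} g _ = ℕP.≤-refl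
    rank≤1 {ℕ.suc (ℕ.suc k)} g independent = ⊥-elim
      (let (μ , g₁∼g₀) = total (g (suc zero)) (g zero)
       in independent⇒not-proportional (λ i → A (g i)) independent μ g₁∼g₀)

    x₀ x₁ : Fin n
    x₀ = proj₁ (distinct-points (proj₁ prim))
    x₁ = proj₁ (proj₂ (distinct-points (proj₁ prim)))

    x₁≢x₀ : x₁ ≢ x₀
    x₁≢x₀ = proj₂ (proj₂ (distinct-points (proj₁ prim)))

    factor : Fin n → Carrier
    factor y = proj₁ (total y x₀)

    factor-spec : ∀ y → y ∼[ factor y ] x₀
    factor-spec y = proj₂ (total y x₀)

    -- |X| < q: y ↦ λ_y is injective (∼-same) and avoids 0.
    n<q : n < q
    n<q = FinP.injective⇒≤ {f = encode} (λ {u} {v} → encode-injective u v)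
      where
      encode : Fin (ℕ.suc n) → Fin q
      encode zero = code 0#
      encode (suc y) = code (factor y)
      encode-injective : ∀ u v → encode u ≡ encode v → u ≡ v
      encode-injective zero zero _ = refl
      encode-injective zero (suc y) eq = ⊥-elim (∼-factor-nonzero (factor-spec y) (≈-sym (code-≡ eq)))
      encode-injective (suc y) zero eq = ⊥-elim (∼-factor-nonzero (factor-spec y) (code-≡ eq))
      encode-injective (suc y) (suc y′) eq =
        ≡.cong suc (∼-same (factor-spec y) (∼-resp (≈-sym (code-≡ eq)) (factor-spec y′)))

    -- Thin: if rel x z ≡ rel x z′ then row z and row z′ are the same multiple of row x.
    thin : Thin S
    thin = thin-if-functional λ {x} {z} {z′} same →
      let (μ , x∼z) = total x z
          (ν , νμ≈1) = ∼-inverse x∼z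
      in ∼-same (∼-flip νμ≈1 x∼z) (∼-flip νμ≈1 (∼-invariant same x∼z))

    -- Powers of a factor are factors: the factors are closed under multiplication.
    powers-are-factors : ∀ {v h} → v ∼[ h ] x₀ → ∀ k → ∃[ w ] w ∼[ h ^ᶠ k ] x₀
    powers-are-factors v∼x₀ ℕ.zero = x₀ , ∼-refl
    powers-are-factors {v} v∼x₀ (ℕ.suc k) =
      let (w , w∼x₀) = powers-are-factors v∼x₀ k
          (w′ , w′w) = in-neighbour w (rel v x₀)
      in w′ , ∼-trans (∼-invariant (≡.sym w′w) v∼x₀) w∼x₀

    -- A factor h ≉ 1 with h ^ b ≈ 1 forces |X| ≤ b: "row x = h ^ k · row y for some k < b"
    -- is an invariant equivalence relation relating v ≢ x₀, hence total, and then the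
    -- exponent k of y relative to x₀ determines y.
    module _ {v h} (v∼x₀ : v ∼[ h ] x₀) (h≉1 : ¬ h ≈ 1#) (b : ℕ) .{{_ : ℕ.NonZero b}} (hᵇ≈1 : h ^ᶠ b ≈ 1#) where
      private
        Power : Fin n → Fin n → Set ℓ
        Power x y = Σ (Fin b) λ k → x ∼[ h ^ᶠ toℕ k ] y

        power : ∀ {x y} j → x ∼[ h ^ᶠ j ] y → Power x y
        power j x∼y = fromℕ< (m%n<n j b) ,
          ∼-resp (≈-trans (^-mod b hᵇ≈1 j) (^-congʳ h (≡.sym (FinP.toℕ-fromℕ< (m%n<n j b))))) x∼y

        Power-sym : ∀ {x y} → Power x y → Power y x
        Power-sym (k , x∼y) = power (b ∸ toℕ k) (∼-flip inverse-power x∼y)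
          where
          inverse-power : h ^ᶠ (b ∸ toℕ k) · h ^ᶠ toℕ k ≈ 1#
          inverse-power = ≈-trans (≈-sym (^-homo-* h (b ∸ toℕ k) (toℕ k)))
            (≈-trans (^-congʳ h (ℕP.m∸n+n≡m (ℕP.<⇒≤ (FinP.toℕ<n k)))) hᵇ≈1)

        Power-trans : ∀ {x y w} → Power x y → Power y w → Power x w
        Power-trans (k , x∼y) (k′ , y∼w) =
          power (toℕ k ℕ.+ toℕ k′) (∼-resp (≈-sym (^-homo-* h (toℕ k) (toℕ k′))) (∼-trans x∼y y∼w))

        v≢x₀ : v ≢ x₀
        v≢x₀ refl = h≉1 (∼-factor-unique v∼x₀ ∼-refl)

        same-exponent : ∀ {y y′} (p : Power y x₀) (p′ : Power y′ x₀) → proj₁ p ≡ proj₁ p′ → y ≡ y′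
        same-exponent (k , y∼x₀) (.k , y′∼x₀) refl = ∼-same y∼x₀ y′∼x₀

      order-bound : n ≤ b
      order-bound = conclude (primitive-trivial Power (λ x y → FinP.any? (λ k → ∼-dec x (h ^ᶠ toℕ k) y))
                               (λ same (k , x∼y) → k , ∼-invariant same x∼y) prim
                               (λ x → power 0 ∼-refl) Power-sym Power-trans)
        where
        conclude : (∀ x y → Power x y → x ≡ y) ⊎ (∀ x y → Power x y) → n ≤ b
        conclude (inj₁ diagonal) = ⊥-elim (v≢x₀ (diagonal v x₀ (power 1 (∼-resp (≈-sym (*-identityʳ h)) v∼x₀))))
        conclude (inj₂ related) = FinP.injective⇒≤ {f = λ y → proj₁ (related y x₀)}
                                    (λ {y} {y′} → same-exponent (related y x₀) (related y′ x₀))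

    -- Among the powers h ^ 0 , … , h ^ |X| two are realised by the same point (pigeonhole),
    -- so some h ^ e with 1 ≤ e ≤ |X| is trivial.
    some-power-trivial : ∀ {v h} → v ∼[ h ] x₀ → ∃[ e ] (h ^ᶠ ℕ.suc e ≈ 1# × ℕ.suc e ≤ n)
    some-power-trivial {v} {h} v∼x₀ = from-collision (FinP.pigeonhole (ℕP.n<1+n n) point)
      where
      point : Fin (ℕ.suc n) → Fin n
      point k = proj₁ (powers-are-factors v∼x₀ (toℕ k))
      from-collision : (∃₂ λ i j → i Fin.< j × point i ≡ point j) → ∃[ e ] (h ^ᶠ ℕ.suc e ≈ 1# × ℕ.suc e ≤ n)
      from-collision (i , j , i<j , same-point) = e , hᵉ≈1 , e≤n
        where
        e = toℕ j ∸ ℕ.suc (toℕ i)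
        j≡e+i : toℕ j ≡ ℕ.suc e ℕ.+ toℕ i
        j≡e+i = ≡.trans (≡.sym (ℕP.m∸n+n≡m i<j)) (ℕP.+-suc e (toℕ i))
        hⁱ≈hʲ : h ^ᶠ toℕ i ≈ h ^ᶠ toℕ j
        hⁱ≈hʲ = ∼-factor-unique (proj₂ (powers-are-factors v∼x₀ (toℕ i)))
          (≡.subst (λ w → w ∼[ h ^ᶠ toℕ j ] x₀) (≡.sym same-point) (proj₂ (powers-are-factors v∼x₀ (toℕ j))))
        hᵉ≈1 : h ^ᶠ ℕ.suc e ≈ 1#
        hᵉ≈1 = cancel (nonzero-^ (∼-factor-nonzero v∼x₀) (toℕ i)) (begin
          h ^ᶠ toℕ i · h ^ᶠ ℕ.suc e   ≈⟨ *-comm _ _ ⟩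
          h ^ᶠ ℕ.suc e · h ^ᶠ toℕ i   ≈⟨ ^-homo-* h (ℕ.suc e) (toℕ i) ⟨
          h ^ᶠ (ℕ.suc e ℕ.+ toℕ i)    ≈⟨ ^-congʳ h (≡.sym j≡e+i) ⟩
          h ^ᶠ toℕ j                  ≈⟨ hⁱ≈hʲ ⟨
          h ^ᶠ toℕ i                  ≈⟨ *-identityʳ _ ⟨
          h ^ᶠ toℕ i · 1#             ∎)
        e≤n : ℕ.suc e ≤ n
        e≤n = ℕP.≤-trans (ℕP.≤-trans (ℕP.m≤m+n (ℕ.suc e) (toℕ i)) (ℕP.≤-reflexive (≡.sym j≡e+i)))
                         (ℕP.≤-pred (FinP.toℕ<n j))

    -- Hence every factor h ≉ 1 has order exactly |X|; in particular h ^ |X| ≈ 1.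
    power-n : ∀ {v h} → v ∼[ h ] x₀ → ¬ h ≈ 1# → h ^ᶠ n ≈ 1#
    power-n {v} {h} v∼x₀ h≉1 =
      let (e , hᵉ≈1 , e≤n) = some-power-trivial v∼x₀
      in ≈-trans (^-congʳ h (ℕP.≤-antisym (order-bound v∼x₀ h≉1 (ℕ.suc e) hᵉ≈1) e≤n)) hᵉ≈1

    g : Carrier
    g = factor x₁

    g≉1 : ¬ g ≈ 1#
    g≉1 g≈1 = x₁≢x₀ (equal-rows (∼-resp g≈1 (factor-spec x₁)))

    -- A divisor 1 < d < |X| with |X| = b d is impossible: if g ^ d ≈ 1 then |X| ≤ d;
    -- otherwise g ^ d is a factor ≉ 1 with (g ^ d) ^ b ≈ g ^ |X| ≈ 1, so |X| ≤ b < |X|.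
    no-proper-divisor : ∀ {d} → 1 < d → d < n → d ∣ n → ⊥
    no-proper-divisor {d} 1<d d<n (divides b n≡bd) = by-cases (g ^ᶠ d ≈? 1#)
      where
      instance
        b≢0 : ℕ.NonZero b
        b≢0 = ℕ.≢-nonZero λ b≡0 → ℕP.<⇒≱ (proj₁ prim)
          (ℕP.≤-trans (ℕP.≤-reflexive (≡.trans n≡bd (≡.cong (_* d) b≡0))) ℕ.z≤n)
      gᵈᵇ≈1 : (g ^ᶠ d) ^ᶠ b ≈ 1#
      gᵈᵇ≈1 = ≈-trans (^-assocʳ g d b)
        (≈-trans (^-congʳ g (≡.trans (ℕP.*-comm d b) (≡.sym n≡bd))) (power-n (factor-spec x₁) g≉1))
      b<n : b < n
      b<n = ≡.subst (b <_) (≡.sym n≡bd) (ℕP.m<m*n b d 1<d)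
      by-cases : Dec (g ^ᶠ d ≈ 1#) → ⊥
      by-cases (yes gᵈ≈1) = ℕP.<⇒≱ d<n (order-bound (factor-spec x₁) g≉1 d {{ℕ.>-nonZero (ℕP.<⇒≤ 1<d)}} gᵈ≈1)
      by-cases (no gᵈ≉1) = ℕP.<⇒≱ b<n (order-bound (proj₂ (powers-are-factors (factor-spec x₁) d)) gᵈ≉1 b gᵈᵇ≈1)

    prime-order : Prime n
    prime-order = prime {{ℕ.n>1⇒nonTrivial (proj₁ prim)}}
      λ (hasNonTrivialDivisor {d} d<n d∣n) → no-proper-divisor (ℕ.nonTrivial⇒n>1 d) d<n d∣n

rank-one-bound-fails : ∀ {n q} → 2 ≤ n → 2 ≤ q → ¬ (n * (q ∸ 1) ≤ q ^ 1 ∸ 1)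
rank-one-bound-fails {n} {ℕ.suc (ℕ.suc q)} 2≤n (ℕ.s≤s (ℕ.s≤s _)) le =
  ℕP.<⇒≱ (≡.subst (ℕ.suc q <_) (ℕP.*-comm (ℕ.suc q) n) (ℕP.m<m*n (ℕ.suc q) n 2≤n))
         (ℕP.≤-trans le (ℕP.≤-reflexive (ℕP.*-identityʳ (ℕ.suc q))))

theorem1p1 : ∀ {c ℓ : Level} (n m : ℕ) (S : AssocScheme n m) → Primitive S →
    (q : ℕ) → IsPrimePower q → (F : Field c ℓ) → HasCard F q →
    (r : ℕ) → FieldMatrices.IsRkMin F S r →
    (r > 1 → n * (q ∸ 1) ≤ q ^ r ∸ 1)
    × (r ≡ 1 → n < q × Thin S × Prime n)
theorem1p1 n m S prim q _ F card r ((a , a∉FJ , (f , independent) , maximal) , _) =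
  rank>1 proportional-trivial , rank≡1 proportional-trivial
  where
  open Rows F card S prim a a∉FJ
  open FiniteField F card using (two≤q)

  rank>1 : Dichotomy → r > 1 → n * (q ∸ 1) ≤ q ^ r ∸ 1
  rank>1 (inj₁ distinct) _ = NonProportional.bound distinct f independent maximal
  rank>1 (inj₂ total) r>1 = ⊥-elim (ℕP.<⇒≱ r>1 (AllProportional.rank≤1 total f independent))

  rank≡1 : Dichotomy → r ≡ 1 → n < q × Thin S × Prime n
  rank≡1 (inj₁ distinct) r≡1 = ⊥-elim (rank-one-bound-fails (proj₁ prim) two≤q
    (≡.subst (λ k → n * (q ∸ 1) ≤ q ^ k ∸ 1) r≡1 (NonProportional.bound distinct f independent maximal)))
  rank≡1 (inj₂ total) _ = n<q , thin , prime-order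
    where open AllProportional total
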